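{- For every integer $k \geq 1$ and every prime power $q$, we have $P(k,\mathbb{F}_q) = O(k,\mathbb{F}_q)$.
   Context: Let $\mathbb{F}_q$ be the finite field with $q$ elements. A sequence $\mathbf{a}=(a_n)_{n\ge 0}$ over $\mathbb{F}_q$ satisfies a linear recurrence of degree $k$ if there are $c_0,\dots,c_{k-1}\in\mathbb{F}_q$ with $c_0 \neq 0$ such that $a_{n+k}=\sum_{i=0}^{k-1}c_i a_{n+i}$ for all $n\ge 0$ (throughout, the coefficient $c_0$ is required to be nonzero). Such a sequence is periodic, and its period $\rho(\mathbf{a})$ is the least $m>0$ with $a_{n+m}=a_n$ for all sufficiently large $n$. For nonzero $f(x)\in\mathbb{F}_q[x]$, write $f(x)=x^r g(x)$ with $r\ge 0$ and $\gcd(g(x),x)=1$; the order $\mathrm{ord}(f(x))$ is the least $n>0$ such that $g(x)$ divides $x^n-1$. Define $P(k,\mathbb{F}_q)=\{\rho(\mathbf{a}) : \mathbf{a} \text{ satisfies a linear recurrence of degree } k \text{ over } \mathbb{F}_q\}$ and $O(k,\mathbb{F}_q)=\{\mathrm{ord}(f(x)) : f(x)\in\mathbb{F}_q[x],\ \deg f(x)=k\}$. -}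

module Defs where

open import Level using (Level; _⊔_)
open import Algebra.Bundles using (CommutativeRing)
open import Data.Nat as ℕ using (ℕ; zero; suc; _≤_; _<_; _^_)
open import Data.Nat.Primality using (Prime)
open import Data.Fin using (Fin; toℕ; fromℕ)
open import Data.List using (List; []; _∷_; map; replicate; _++_; [_])
open import Data.Product using (Σ; ∃; ∃-syntax; _×_; _,_)
open import Relation.Binary.PropositionalEquality using (_≡_)
open import Relation.Nullary using (¬_)
open import Data.Empty.Polymorphic using (⊥)

IsPrimePower : ℕ → Set
IsPrimePower q = ∃[ p ] ∃[ e ] (Prime p × 1 ≤ e × q ≡ p ^ e)

module _ {c ℓ : Level} (R : CommutativeRing c ℓ) where
  open CommutativeRing R renaming (Carrier to F)

  IsField : Set (c ⊔ ℓ)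
  IsField = (¬ (1# ≈ 0#)) × (∀ x → ¬ (x ≈ 0#) → ∃[ y ] (x * y ≈ 1#))

  sumFin : (k : ℕ) → (Fin k → F) → F
  sumFin zero    f = 0#
  sumFin (suc k) f = f Fin.zero + sumFin k (λ i → f (Fin.suc i))

  SatisfiesRecurrence : (k : ℕ) → (ℕ → F) → Set (c ⊔ ℓ)
  SatisfiesRecurrence zero    a = ⊥  -- degree 0 needs c₀ ≠ 0 with no coefficients: impossible
  SatisfiesRecurrence (suc k) a =
    Σ (Fin (suc k) → F) λ cs →
      (¬ (cs Fin.zero ≈ 0#)) ×
      (∀ n → a (n ℕ.+ suc k) ≈ sumFin (suc k) (λ i → cs i * a (n ℕ.+ toℕ i)))

  IsEventualPeriod : (ℕ → F) → ℕ → Set ℓ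
  IsEventualPeriod a m = (0 < m) × ∃[ N ] (∀ n → N ≤ n → a (n ℕ.+ m) ≈ a n)

  HasPeriod : (ℕ → F) → ℕ → Set ℓ
  HasPeriod a m = IsEventualPeriod a m × (∀ m' → IsEventualPeriod a m' → m ≤ m')

  P : ℕ → ℕ → Set (c ⊔ ℓ)
  P k m = Σ (ℕ → F) λ a → SatisfiesRecurrence k a × HasPeriod a m

  -- Polynomials as coefficient lists (constant term first)

  Poly : Set c
  Poly = List F

  coeff : Poly → ℕ → F
  coeff []      _       = 0#
  coeff (a ∷ p) zero    = a
  coeff (a ∷ p) (suc i) = coeff p i

  -- equality of polynomials (coefficientwise, trailing zeros ignored)
  _≈ₚ_ : Poly → Poly → Set ℓ
  p ≈ₚ q = ∀ i → coeff p i ≈ coeff q i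

  _+ₚ_ : Poly → Poly → Poly
  []      +ₚ q       = q
  (a ∷ p) +ₚ []      = a ∷ p
  (a ∷ p) +ₚ (b ∷ q) = (a + b) ∷ (p +ₚ q)

  _*ₚ_ : Poly → Poly → Poly
  []      *ₚ q = []
  (a ∷ p) *ₚ q = map (a *_) q +ₚ (0# ∷ (p *ₚ q))

  _∣ₚ_ : Poly → Poly → Set (c ⊔ ℓ)
  g ∣ₚ h = ∃[ u ] ((g *ₚ u) ≈ₚ h)

  X^ : ℕ → Poly
  X^ n = replicate n 0# ++ [ 1# ]

  X^-1 : ℕ → Poly
  X^-1 n = X^ n +ₚ [ - 1# ]

  -- gcd(g, h) = 1 : every common divisor is a unit (divides 1)
  CoprimeP : Poly → Poly → Set (c ⊔ ℓ)
  CoprimeP g h = ∀ d → d ∣ₚ g → d ∣ₚ h → d ∣ₚ [ 1# ]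

  toPoly : (k : ℕ) → (Fin (suc k) → F) → Poly
  toPoly k f = Data.List.tabulate f

  HasOrder : Poly → ℕ → Set (c ⊔ ℓ)
  HasOrder f n =
    ∃[ r ] ∃[ g ] ( (f ≈ₚ (X^ r *ₚ g)) × CoprimeP g (X^ 1)
                  × 0 < n × (g ∣ₚ X^-1 n)
                  × (∀ n' → 0 < n' → g ∣ₚ X^-1 n' → n ≤ n') )

  O : ℕ → ℕ → Set (c ⊔ ℓ)
  O k m = Σ (Fin (suc k) → F) λ f →
            (¬ (f (fromℕ k) ≈ 0#)) × HasOrder (toPoly k f) m

-- A polynomial p acts on sequences by (p · b) n = Σᵢ pᵢ b (n + i). This is a ring homomorphism into
-- commuting operators, coefficients are recovered by acting on unit impulses, and m is an eventual
-- period of b exactly when x^m − 1 annihilates b from some index on.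
--
-- P ⊆ O: for a periodic solution a of a recurrence of degree k, let g be a monic polynomial of least
-- degree annihilating a from some N on (found by exhaustive search, since F is finite). Division with
-- remainder shows that g divides every such annihilator, so x^m − 1 is an eventual annihilator iff
-- g ∣ x^m − 1, i.e. ρ(a) = ord(g); periodicity forces g(0) ≠ 0, and f = x^(k − deg g) g has degree k.
--
-- O ⊆ P: for f = x^r g of degree k, the impulse response a of g made monic has no
-- annihilator of smaller degree, and as g(0) ≠ 0 an eventual annihilator of a is a genuine one, so
-- again ρ(a) = ord(g); a satisfies the recurrence given by (x^j + 1) g, which has degree k.
module Submission where

open import Defs
open import Algebra.Bundles using (CommutativeRing)
open import Data.Nat using (ℕ; _≤_)
open import Data.Fin using (Fin)
open import Function.Bundles using (Bijection; _⇔_)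
open import Relation.Binary.PropositionalEquality using (setoid)

open import Level using (Level; _⊔_)
open import Data.Nat as ℕ using (zero; suc; _<_; z≤n; s≤s)
import Data.Nat.Properties as ℕₚ
open import Data.Nat.DivMod using (_/_; m%n<n; m≡m%n+[m/n]*n)
open import Data.Fin as Fin using (toℕ; fromℕ)
import Data.Fin.Properties as Finₚ
open import Data.List as List using (List; []; _∷_; map; replicate; _++_; [_]; _∷ʳ_; length; tabulate)
open import Data.List.Reverse using (Reverse; reverseView; []; _∶_∶ʳ_)
import Data.List.Properties as Listₚ
open import Data.Product using (Σ; ∃-syntax; _×_; _,_; proj₁; proj₂)
open import Data.Sum using (_⊎_; inj₁; inj₂; [_,_]′)
open import Function.Bundles using (mk⇔)
open import Data.List.Relation.Binary.Pointwise using (Pointwise; []; _∷_; ++⁺)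
import Data.List.Relation.Binary.Pointwise.Properties as Pointwiseₚ
open import Data.Empty using (⊥-elim)
open import Relation.Binary.PropositionalEquality as ≡ using (_≡_)
open import Relation.Nullary using (¬_; Dec; yes; no)
open import Relation.Binary.Definitions using (Decidable)

length-∷ʳ : ∀ {a} {A : Set a} (xs : List A) x → length (xs ∷ʳ x) ≡ suc (length xs)
length-∷ʳ xs x = ≡.trans (Listₚ.length-++ xs) (ℕₚ.+-comm (length xs) 1)

module PolynomialAction {c ℓ : Level} (R : CommutativeRing c ℓ) where
  open CommutativeRing R renaming (Carrier to F)
  open import Relation.Binary.Reasoning.Setoid (CommutativeRing.setoid R)
  open import Algebra.Solver.Ring.NaturalCoefficients.Default commutativeSemiring
    using (solve; _:=_; _:+_; _:*_)
  open import Algebra.Properties.Ring ring using (-‿distribˡ-*; -0#≈0#; -1*x≈-x)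
  open import Algebra.Properties.AbelianGroup +-abelianGroup using (⁻¹-∙-comm; xyx⁻¹≈y)
  open import Algebra.Properties.Group +-group using (x∙y⁻¹≈ε⇒x≈y; ⁻¹-injective; inverseʳ-unique)

  infixl 6 _⊞_
  infixl 7 _⊠_

  _⊞_ : Poly R → Poly R → Poly R
  _⊞_ = _+ₚ_ R

  _⊠_ : Poly R → Poly R → Poly R
  _⊠_ = _*ₚ_ R

  coef : Poly R → ℕ → F
  coef = coeff R

  Seq : Set c
  Seq = ℕ → F

  act : Poly R → Seq → Seq
  act []      b n = 0#
  act (x ∷ p) b n = x * b n + act p b (suc n)

  act-local : ∀ p {b b' : Seq} {n n'} →
              (∀ i → i < length p → b (n ℕ.+ i) ≈ b' (n' ℕ.+ i)) → act p b n ≈ act p b' n'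
  act-local []      h = refl
  act-local (x ∷ p) {b} {b'} {n} {n'} h = +-cong (*-cong refl head) (act-local p tail)
    where
    head : b n ≈ b' n'
    head = ≡.subst₂ _≈_ (≡.cong b (ℕₚ.+-identityʳ n)) (≡.cong b' (ℕₚ.+-identityʳ n')) (h 0 (s≤s z≤n))
    tail : ∀ i → i < length p → b (suc n ℕ.+ i) ≈ b' (suc n' ℕ.+ i)
    tail i i< = ≡.subst₂ _≈_ (≡.cong b (ℕₚ.+-suc n i)) (≡.cong b' (ℕₚ.+-suc n' i)) (h (suc i) (s≤s i<))

  act-cong : ∀ p {b b' : Seq} {n} → (∀ i → b i ≈ b' i) → act p b n ≈ act p b' n
  act-cong p h = act-local p (λ i _ → h _)

  act-0 : ∀ p n → act p (λ _ → 0#) n ≈ 0#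
  act-0 []      n = refl
  act-0 (x ∷ p) n = trans (+-cong (zeroʳ x) (act-0 p (suc n))) (+-identityʳ 0#)

  act-vanishing : ∀ p {b : Seq} {n} → (∀ i → i < length p → b (n ℕ.+ i) ≈ 0#) → act p b n ≈ 0#
  act-vanishing p {n = n} h = trans (act-local p {n' = n} h) (act-0 p n)

  act-vanishing-everywhere : ∀ p {b : Seq} {n} → (∀ i → b i ≈ 0#) → act p b n ≈ 0#
  act-vanishing-everywhere p h = act-vanishing p (λ i _ → h _)

  act-suc : ∀ p (b : Seq) n → act p (λ i → b (suc i)) n ≡ act p b (suc n)
  act-suc []      b n = ≡.refl
  act-suc (x ∷ p) b n = ≡.cong (x * b (suc n) +_) (act-suc p b (suc n))

  act-+ : ∀ p (b e : Seq) n → act p (λ i → b i + e i) n ≈ act p b n + act p e n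
  act-+ []      b e n = sym (+-identityʳ 0#)
  act-+ (x ∷ p) b e n = begin
    x * (b n + e n) + act p (λ i → b i + e i) (suc n)     ≈⟨ +-cong refl (act-+ p b e (suc n)) ⟩
    x * (b n + e n) + (act p b (suc n) + act p e (suc n))
      ≈⟨ solve 5 (λ x u v A B → x :* (u :+ v) :+ (A :+ B) := (x :* u :+ A) :+ (x :* v :+ B)) refl x (b n) (e n) (act p b (suc n)) (act p e (suc n)) ⟩
    (x * b n + act p b (suc n)) + (x * e n + act p e (suc n)) ∎

  act-* : ∀ p y (b : Seq) n → act p (λ i → y * b i) n ≈ y * act p b n
  act-* []      y b n = sym (zeroʳ y)
  act-* (x ∷ p) y b n = begin
    x * (y * b n) + act p (λ i → y * b i) (suc n) ≈⟨ +-cong refl (act-* p y b (suc n)) ⟩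
    x * (y * b n) + y * act p b (suc n)           ≈⟨ solve 4 (λ x y u A → x :* (y :* u) :+ y :* A := y :* (x :* u :+ A)) refl x y (b n) (act p b (suc n)) ⟩
    y * (x * b n + act p b (suc n))               ∎

  act-⊞ : ∀ p q (b : Seq) n → act (p ⊞ q) b n ≈ act p b n + act q b n
  act-⊞ []      q       b n = sym (+-identityˡ _)
  act-⊞ (x ∷ p) []      b n = sym (+-identityʳ _)
  act-⊞ (x ∷ p) (y ∷ q) b n = begin
    (x + y) * b n + act (p ⊞ q) b (suc n)               ≈⟨ +-cong refl (act-⊞ p q b (suc n)) ⟩
    (x + y) * b n + (act p b (suc n) + act q b (suc n))
      ≈⟨ solve 5 (λ x y u A B → (x :+ y) :* u :+ (A :+ B) := (x :* u :+ A) :+ (y :* u :+ B)) refl x y (b n) (act p b (suc n)) (act q b (suc n)) ⟩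
    (x * b n + act p b (suc n)) + (y * b n + act q b (suc n)) ∎

  act-scale : ∀ p y (b : Seq) n → act (map (y *_) p) b n ≈ y * act p b n
  act-scale []      y b n = sym (zeroʳ y)
  act-scale (x ∷ p) y b n = begin
    y * x * b n + act (map (y *_) p) b (suc n) ≈⟨ +-cong refl (act-scale p y b (suc n)) ⟩
    y * x * b n + y * act p b (suc n)          ≈⟨ solve 4 (λ x y u A → y :* x :* u :+ y :* A := y :* (x :* u :+ A)) refl x y (b n) (act p b (suc n)) ⟩
    y * (x * b n + act p b (suc n))            ∎

  act-⊠ : ∀ p q (b : Seq) n → act (p ⊠ q) b n ≈ act p (act q b) n
  act-⊠ []      q b n = refl
  act-⊠ (x ∷ p) q b n = begin
    act (map (x *_) q ⊞ (0# ∷ p ⊠ q)) b n                      ≈⟨ act-⊞ (map (x *_) q) (0# ∷ p ⊠ q) b n ⟩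
    act (map (x *_) q) b n + (0# * b n + act (p ⊠ q) b (suc n)) ≈⟨ +-cong (act-scale q x b n) (+-cong (zeroˡ _) (act-⊠ p q b (suc n))) ⟩
    x * act q b n + (0# + act p (act q b) (suc n))              ≈⟨ +-cong refl (+-identityˡ _) ⟩
    x * act q b n + act p (act q b) (suc n)                     ∎

  act-comm : ∀ p q (b : Seq) n → act p (act q b) n ≈ act q (act p b) n
  act-comm []      q b n = sym (act-0 q n)
  act-comm (x ∷ p) q b n = begin
    x * act q b n + act p (act q b) (suc n)                   ≈⟨ +-cong refl (act-comm p q b (suc n)) ⟩
    x * act q b n + act q (act p b) (suc n)                   ≈⟨ +-cong (sym (act-* q x b n)) (reflexive (≡.sym (act-suc q (act p b) n))) ⟩
    act q (λ i → x * b i) n + act q (λ i → act p b (suc i)) n ≈⟨ sym (act-+ q (λ i → x * b i) (λ i → act p b (suc i)) n) ⟩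
    act q (λ i → x * b i + act p b (suc i)) n                 ∎

  act-∷ʳ : ∀ p x (b : Seq) n → act (p ∷ʳ x) b n ≈ act p b n + x * b (n ℕ.+ length p)
  act-∷ʳ []      x b n = begin
    x * b n + 0#         ≈⟨ +-identityʳ _ ⟩
    x * b n              ≡⟨ ≡.cong (λ i → x * b i) (≡.sym (ℕₚ.+-identityʳ n)) ⟩
    x * b (n ℕ.+ 0)      ≈⟨ sym (+-identityˡ _) ⟩
    0# + x * b (n ℕ.+ 0) ∎
  act-∷ʳ (y ∷ p) x b n = begin
    y * b n + act (p ∷ʳ x) b (suc n)                           ≈⟨ +-cong refl (act-∷ʳ p x b (suc n)) ⟩
    y * b n + (act p b (suc n) + x * b (suc n ℕ.+ length p))   ≈⟨ sym (+-assoc _ _ _) ⟩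
    y * b n + act p b (suc n) + x * b (suc n ℕ.+ length p)     ≡⟨ ≡.cong (λ i → y * b n + act p b (suc n) + x * b i) (≡.sym (ℕₚ.+-suc n (length p))) ⟩
    y * b n + act p b (suc n) + x * b (n ℕ.+ suc (length p))   ∎

  -- X^ j ⊠ p, written without a multiplication
  shiftₚ : ℕ → Poly R → Poly R
  shiftₚ j p = replicate j 0# ++ p

  act-shiftₚ : ∀ j p (b : Seq) n → act (shiftₚ j p) b n ≈ act p b (j ℕ.+ n)
  act-shiftₚ zero    p b n = refl
  act-shiftₚ (suc j) p b n = begin
    0# * b n + act (shiftₚ j p) b (suc n) ≈⟨ +-cong (zeroˡ _) (act-shiftₚ j p b (suc n)) ⟩
    0# + act p b (j ℕ.+ suc n)            ≈⟨ +-identityˡ _ ⟩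
    act p b (j ℕ.+ suc n)                 ≡⟨ ≡.cong (act p b) (ℕₚ.+-suc j n) ⟩
    act p b (suc j ℕ.+ n)                 ∎

  act-X^ : ∀ j (b : Seq) n → act (X^ R j) b n ≈ b (n ℕ.+ j)
  act-X^ j b n = begin
    act (shiftₚ j [ 1# ]) b n ≈⟨ act-shiftₚ j [ 1# ] b n ⟩
    1# * b (j ℕ.+ n) + 0#     ≈⟨ +-identityʳ _ ⟩
    1# * b (j ℕ.+ n)          ≈⟨ *-identityˡ _ ⟩
    b (j ℕ.+ n)               ≡⟨ ≡.cong b (ℕₚ.+-comm j n) ⟩
    b (n ℕ.+ j)               ∎

  act-X^-1 : ∀ j (b : Seq) n → act (X^-1 R j) b n ≈ b (n ℕ.+ j) - b n
  act-X^-1 j b n = begin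
    act (X^ R j ⊞ [ - 1# ]) b n         ≈⟨ act-⊞ (X^ R j) [ - 1# ] b n ⟩
    act (X^ R j) b n + (- 1# * b n + 0#) ≈⟨ +-cong (act-X^ j b n) (+-identityʳ _) ⟩
    b (n ℕ.+ j) + - 1# * b n             ≈⟨ +-cong refl (-1*x≈-x (b n)) ⟩
    b (n ℕ.+ j) - b n                    ∎

  periodic⇒annihilated : ∀ m (b : Seq) n → b (n ℕ.+ m) ≈ b n → act (X^-1 R m) b n ≈ 0#
  periodic⇒annihilated m b n per = trans (act-X^-1 m b n) (trans (+-cong per refl) (-‿inverseʳ _))

  annihilated⇒periodic : ∀ m (b : Seq) n → act (X^-1 R m) b n ≈ 0# → b (n ℕ.+ m) ≈ b n
  annihilated⇒periodic m b n h = x∙y⁻¹≈ε⇒x≈y _ _ (trans (sym (act-X^-1 m b n)) h)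

  δ : ℕ → Seq
  δ zero    zero    = 1#
  δ zero    (suc n) = 0#
  δ (suc j) zero    = 0#
  δ (suc j) (suc n) = δ j n

  act-δ : ∀ p j → act p (δ j) 0 ≈ coef p j
  act-δ []      j       = refl
  act-δ (x ∷ p) zero    = begin
    x * 1# + act p (δ 0) 1 ≡⟨ ≡.cong (x * 1# +_) (≡.sym (act-suc p (δ 0) 0)) ⟩
    x * 1# + act p (λ _ → 0#) 0 ≈⟨ +-cong (*-identityʳ x) (act-0 p 0) ⟩
    x + 0#                 ≈⟨ +-identityʳ x ⟩
    x                      ∎
  act-δ (x ∷ p) (suc j) = begin
    x * 0# + act p (δ (suc j)) 1 ≡⟨ ≡.cong (x * 0# +_) (≡.sym (act-suc p (δ (suc j)) 0)) ⟩
    x * 0# + act p (δ j) 0       ≈⟨ +-cong (zeroʳ x) (act-δ p j) ⟩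
    0# + coef p j                ≈⟨ +-identityˡ _ ⟩
    coef p j                     ∎

  infix 4 _≅_
  _≅_ : Poly R → Poly R → Set (c ⊔ ℓ)
  p ≅ q = ∀ b n → act p b n ≈ act q b n

  ≅⇒≈ₚ : ∀ {p q} → p ≅ q → _≈ₚ_ R p q
  ≅⇒≈ₚ {p} {q} h j = trans (sym (act-δ p j)) (trans (h (δ j) 0) (act-δ q j))

  act-≈ₚ[] : ∀ q → _≈ₚ_ R [] q → ∀ b n → act q b n ≈ 0#
  act-≈ₚ[] []      h b n = refl
  act-≈ₚ[] (y ∷ q) h b n = begin
    y * b n + act q b (suc n) ≈⟨ +-cong (*-cong (sym (h 0)) refl) (act-≈ₚ[] q (λ i → h (suc i)) b (suc n)) ⟩
    0# * b n + 0#             ≈⟨ +-identityʳ _ ⟩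
    0# * b n                  ≈⟨ zeroˡ _ ⟩
    0#                        ∎

  ≈ₚ⇒≅ : ∀ {p q} → _≈ₚ_ R p q → p ≅ q
  ≈ₚ⇒≅ {[]}    {q}     h b n = sym (act-≈ₚ[] q h b n)
  ≈ₚ⇒≅ {x ∷ p} {[]}    h b n = act-≈ₚ[] (x ∷ p) (λ i → sym (h i)) b n
  ≈ₚ⇒≅ {x ∷ p} {y ∷ q} h b n = +-cong (*-cong (h 0) refl) (≈ₚ⇒≅ {p} {q} (λ i → h (suc i)) b (suc n))

  Pointwise⇒≅ : ∀ {p q} → Pointwise _≈_ p q → p ≅ q
  Pointwise⇒≅ []             b n = refl
  Pointwise⇒≅ (x≈y ∷ p≈q) b n = +-cong (*-cong x≈y refl) (Pointwise⇒≅ p≈q b (suc n))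

  ∷ʳ0≅ : ∀ p {x} → x ≈ 0# → p ∷ʳ x ≅ p
  ∷ʳ0≅ p {x} x≈0 b n = begin
    act (p ∷ʳ x) b n                ≈⟨ act-∷ʳ p x b n ⟩
    act p b n + x * b (n ℕ.+ length p) ≈⟨ +-cong refl (trans (*-cong x≈0 refl) (zeroˡ _)) ⟩
    act p b n + 0#                  ≈⟨ +-identityʳ _ ⟩
    act p b n                       ∎

  act-coef₀≈0 : ∀ p → coef p 0 ≈ 0# → ∀ b n → act p b n ≈ act (List.drop 1 p) b (suc n)
  act-coef₀≈0 []      _   b n = refl
  act-coef₀≈0 (x ∷ p) x≈0 b n = trans (+-cong (trans (*-cong x≈0 refl) (zeroˡ _)) refl) (+-identityˡ _)

  X^⊠≅shiftₚ : ∀ r g → X^ R r ⊠ g ≅ shiftₚ r g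
  X^⊠≅shiftₚ r g b n = begin
    act (X^ R r ⊠ g) b n         ≈⟨ act-⊠ (X^ R r) g b n ⟩
    act (X^ R r) (act g b) n     ≈⟨ act-X^ r (act g b) n ⟩
    act g b (n ℕ.+ r)            ≡⟨ ≡.cong (act g b) (ℕₚ.+-comm n r) ⟩
    act g b (r ℕ.+ n)            ≈⟨ sym (act-shiftₚ r g b n) ⟩
    act (shiftₚ r g) b n         ∎

  coef-⊞ : ∀ p q i → coef (p ⊞ q) i ≈ coef p i + coef q i
  coef-⊞ []      q       i       = sym (+-identityˡ _)
  coef-⊞ (x ∷ p) []      i       = sym (+-identityʳ _)
  coef-⊞ (x ∷ p) (y ∷ q) zero    = refl
  coef-⊞ (x ∷ p) (y ∷ q) (suc i) = coef-⊞ p q i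

  coef-scale : ∀ p y i → coef (map (y *_) p) i ≈ y * coef p i
  coef-scale []      y i       = sym (zeroʳ y)
  coef-scale (x ∷ p) y zero    = refl
  coef-scale (x ∷ p) y (suc i) = coef-scale p y i

  coef-⊠-0 : ∀ p q → coef (p ⊠ q) 0 ≈ coef p 0 * coef q 0
  coef-⊠-0 []      q = sym (zeroˡ _)
  coef-⊠-0 (x ∷ p) q = trans (coef-⊞ (map (x *_) q) (0# ∷ p ⊠ q) 0) (trans (+-identityʳ _) (coef-scale q x 0))

  coef-beyond : ∀ p {i} → length p ≤ i → coef p i ≡ 0#
  coef-beyond []      _       = ≡.refl
  coef-beyond (x ∷ p) (s≤s h) = coef-beyond p h

  coef-tabulate : ∀ {L} (f : Fin L → F) i → coef (tabulate f) (toℕ i) ≡ f i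
  coef-tabulate f Fin.zero    = ≡.refl
  coef-tabulate f (Fin.suc i) = coef-tabulate (λ z → f (Fin.suc z)) i

  tabulate-coef : ∀ L p → length p ≤ L → _≈ₚ_ R (tabulate {n = L} (λ i → coef p (toℕ i))) p
  tabulate-coef zero    []      _       i       = refl
  tabulate-coef (suc L) []      _       zero    = refl
  tabulate-coef (suc L) []      _       (suc i) = tabulate-coef L [] z≤n i
  tabulate-coef (suc L) (x ∷ p) _       zero    = refl
  tabulate-coef (suc L) (x ∷ p) (s≤s h) (suc i) = tabulate-coef L p h i

  coef-∷ʳ : ∀ p x → coef (p ∷ʳ x) (length p) ≡ x
  coef-∷ʳ []      x = ≡.refl
  coef-∷ʳ (y ∷ p) x = coef-∷ʳ p x

  coef-∷ʳ-< : ∀ p x {i} → i < length p → coef (p ∷ʳ x) i ≡ coef p i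
  coef-∷ʳ-< (y ∷ p) x {zero}  _       = ≡.refl
  coef-∷ʳ-< (y ∷ p) x {suc i} (s≤s h) = coef-∷ʳ-< p x h

  coef-replicate-0 : ∀ e i → coef (replicate e 0#) i ≡ 0#
  coef-replicate-0 zero    i       = ≡.refl
  coef-replicate-0 (suc e) zero    = ≡.refl
  coef-replicate-0 (suc e) (suc i) = coef-replicate-0 e i

  coef-shiftₚ : ∀ j p i → coef (shiftₚ j p) (j ℕ.+ i) ≡ coef p i
  coef-shiftₚ zero    p i = ≡.refl
  coef-shiftₚ (suc j) p i = coef-shiftₚ j p i

  length-shiftₚ : ∀ j p → length (shiftₚ j p) ≡ j ℕ.+ length p
  length-shiftₚ j p = ≡.trans (Listₚ.length-++ (replicate j 0#)) (≡.cong (ℕ._+ length p) (Listₚ.length-replicate j))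

  length-⊞-≡ : ∀ p q → length p ≡ length q → length (p ⊞ q) ≡ length p
  length-⊞-≡ []      []      _  = ≡.refl
  length-⊞-≡ (x ∷ p) (y ∷ q) eq = ≡.cong suc (length-⊞-≡ p q (ℕₚ.suc-injective eq))

  length-⊞ : ∀ p q {L} → length p ≤ L → length q ≤ L → length (p ⊞ q) ≤ L
  length-⊞ []      q       hp      hq      = hq
  length-⊞ (x ∷ p) []      hp      hq      = hp
  length-⊞ (x ∷ p) (y ∷ q) (s≤s hp) (s≤s hq) = s≤s (length-⊞ p q hp hq)

  sumFin-cong : ∀ L {f g : Fin L → F} → (∀ i → f i ≈ g i) → sumFin R L f ≈ sumFin R L g
  sumFin-cong zero    h = refl
  sumFin-cong (suc L) h = +-cong (h Fin.zero) (sumFin-cong L (λ i → h (Fin.suc i)))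

  sumFin-0 : ∀ L {f : Fin L → F} → (∀ i → f i ≈ 0#) → sumFin R L f ≈ 0#
  sumFin-0 zero    h = refl
  sumFin-0 (suc L) h = trans (+-cong (h Fin.zero) (sumFin-0 L (λ i → h (Fin.suc i)))) (+-identityʳ _)

  sumFin-neg : ∀ L (f : Fin L → F) → sumFin R L (λ i → - f i) ≈ - sumFin R L f
  sumFin-neg zero    f = sym -0#≈0#
  sumFin-neg (suc L) f = trans (+-cong refl (sumFin-neg L (λ i → f (Fin.suc i)))) (⁻¹-∙-comm _ _)

  sumFin-last : ∀ L (f : Fin (suc L) → F) →
                sumFin R (suc L) f ≈ sumFin R L (λ i → f (Fin.inject₁ i)) + f (fromℕ L)
  sumFin-last zero    f = trans (+-identityʳ _) (sym (+-identityˡ _))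
  sumFin-last (suc L) f = trans (+-cong refl (sumFin-last L (λ i → f (Fin.suc i)))) (sym (+-assoc _ _ _))

  act-sumFin : ∀ L p → length p ≤ L → ∀ (b : Seq) n →
               act p b n ≈ sumFin R L (λ i → coef p (toℕ i) * b (n ℕ.+ toℕ i))
  act-sumFin zero    []      _       b n = refl
  act-sumFin (suc L) []      _       b n = sym (sumFin-0 (suc L) (λ i → zeroˡ (b (n ℕ.+ toℕ i))))
  act-sumFin (suc L) (x ∷ p) (s≤s h) b n =
    +-cong (*-cong refl (reflexive (≡.cong b (≡.sym (ℕₚ.+-identityʳ n)))))
           (trans (act-sumFin L p h b (suc n))
                  (sumFin-cong L (λ i → *-cong refl (reflexive (≡.cong b (≡.sym (ℕₚ.+-suc n (toℕ i))))))))

  Recurrence : (K : ℕ) → (Fin K → F) → Seq → Set ℓ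
  Recurrence K cs a = ∀ n → a (n ℕ.+ K) ≈ sumFin R K (λ i → cs i * a (n ℕ.+ toℕ i))

  charPoly : (K : ℕ) → (Fin K → F) → Poly R
  charPoly K cs = tabulate (λ i → - cs i) ∷ʳ 1#

  recurrence⇒charPoly-annihilates : ∀ K cs a → Recurrence K cs a → ∀ n → act (charPoly K cs) a n ≈ 0#
  recurrence⇒charPoly-annihilates K cs a rec n = begin
    act (hb ∷ʳ 1#) a n                                            ≈⟨ act-∷ʳ hb 1# a n ⟩
    act hb a n + 1# * a (n ℕ.+ length hb)                          ≈⟨ +-cong (act-sumFin K hb (ℕₚ.≤-reflexive |hb|) a n) (*-identityˡ _) ⟩
    sumFin R K (λ i → coef hb (toℕ i) * a (n ℕ.+ toℕ i)) + a (n ℕ.+ length hb)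
      ≈⟨ +-cong (sumFin-cong K (λ i → trans (*-cong (reflexive (coef-tabulate _ i)) refl) (sym (-‿distribˡ-* _ _))))
                (reflexive (≡.cong (λ j → a (n ℕ.+ j)) |hb|)) ⟩
    sumFin R K (λ i → - (cs i * a (n ℕ.+ toℕ i))) + a (n ℕ.+ K)   ≈⟨ +-cong (trans (sumFin-neg K _) (-‿cong (sym (rec n)))) refl ⟩
    - a (n ℕ.+ K) + a (n ℕ.+ K)                                    ≈⟨ -‿inverseˡ _ ⟩
    0#                                                             ∎
    where
    hb : Poly R
    hb = tabulate (λ i → - cs i)
    |hb| : length hb ≡ K
    |hb| = Listₚ.length-tabulate _

  annihilator⇒recurrence : ∀ k H a → (∀ n → act H a n ≈ 0#) → length H ≤ suc (suc k) →
                           coef H (suc k) ≈ 1# → ¬ (coef H 0 ≈ 0#) → SatisfiesRecurrence R (suc k) a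
  annihilator⇒recurrence k H a annihilates |H| monic H₀≉0 =
    (λ i → - coef H (toℕ i)) , (λ -H₀≈0 → H₀≉0 (⁻¹-injective (trans -H₀≈0 (sym -0#≈0#)))) , rec
    where
    K : ℕ
    K = suc k
    term : ℕ → ℕ → F
    term j n = coef H j * a (n ℕ.+ j)
    split : ∀ n → sumFin R K (λ i → term (toℕ i) n) + a (n ℕ.+ K) ≈ 0#
    split n = begin
      sumFin R K (λ i → term (toℕ i) n) + a (n ℕ.+ K)
        ≈⟨ +-cong (sumFin-cong K (λ i → reflexive (≡.cong (λ j → term j n) (≡.sym (Finₚ.toℕ-inject₁ i)))))
                  (sym (trans (reflexive (≡.cong (λ j → term j n) (Finₚ.toℕ-fromℕ K)))
                              (trans (*-cong monic refl) (*-identityˡ _)))) ⟩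
      sumFin R K (λ i → term (toℕ (Fin.inject₁ i)) n) + term (toℕ (fromℕ K)) n ≈⟨ sym (sumFin-last K (λ i → term (toℕ i) n)) ⟩
      sumFin R (suc K) (λ i → term (toℕ i) n)                                 ≈⟨ sym (act-sumFin (suc K) H |H| a n) ⟩
      act H a n                                                               ≈⟨ annihilates n ⟩
      0#                                                                      ∎
    rec : ∀ n → a (n ℕ.+ K) ≈ sumFin R K (λ i → - coef H (toℕ i) * a (n ℕ.+ toℕ i))
    rec n = trans (inverseʳ-unique _ _ (split n))
                  (sym (trans (sumFin-cong K (λ i → sym (-‿distribˡ-* (coef H (toℕ i)) (a (n ℕ.+ toℕ i))))) (sumFin-neg K (λ i → term (toℕ i) n))))

  record Division (gb p : Poly R) : Set (c ⊔ ℓ) where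
    constructor division
    field
      quotient remainder : Poly R
      length-remainder   : length remainder ≡ length gb
      act-division       : ∀ b n → act p b n ≈ act quotient (act (gb ∷ʳ 1#) b) n + act remainder b n

  act-replicate-0 : ∀ j (b : Seq) n → act (replicate j 0#) b n ≈ 0#
  act-replicate-0 j b n = ≡.subst (λ p → act p b n ≈ 0#) (Listₚ.++-identityʳ (replicate j 0#)) (act-shiftₚ j [] b n)

  act-[1] : ∀ (b : Seq) n → act [ 1# ] b n ≈ b n
  act-[1] b n = trans (+-identityʳ _) (*-identityˡ _)

  private
    rearrange : ∀ X S T Y Z → X + (S + (T + Y)) ≈ (Z + (Y + S)) + ((X + T) + - Z)
    rearrange X S T Y Z = begin
      X + (S + (T + Y))                   ≈⟨ sym (xyx⁻¹≈y Z _) ⟩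
      Z + (X + (S + (T + Y))) + - Z
        ≈⟨ solve 6 (λ X S T Y Z W → Z :+ (X :+ (S :+ (T :+ Y))) :+ W := (Z :+ (Y :+ S)) :+ ((X :+ T) :+ W)) refl X S T Y Z (- Z) ⟩
      (Z + (Y + S)) + ((X + T) + - Z)     ∎

  divide-∷ : ∀ gb x {p} → Division gb p → Division gb (x ∷ p)
  divide-∷ gb x (division s t |t| eq) with reverseView t
  divide-∷ [] x {p} (division s .[] |t| eq) | [] =
    division (x ∷ s) [] ≡.refl λ b n → begin
      x * b n + act p b (suc n)                        ≈⟨ +-cong (*-cong refl (sym (act-[1] b n))) (trans (eq b (suc n)) (+-identityʳ _)) ⟩
      x * act [ 1# ] b n + act s (act [ 1# ] b) (suc n) ≈⟨ sym (+-identityʳ _) ⟩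
      x * act [ 1# ] b n + act s (act [ 1# ] b) (suc n) + 0# ∎
  divide-∷ (_ ∷ _) x (division s .[] () eq) | []
  -- With d = length gb and G = gb ∷ʳ 1#: x + X (s G + t₀ + y X^d) = (y + X s) G + (x + X t₀ − y gb).
  divide-∷ gb x {p} (division s .(t₀ ∷ʳ y) |t| eq) | t₀ ∶ _ ∶ʳ y =
    division (y ∷ s) ((x ∷ t₀) ⊞ map (- y *_) gb) |remainder| proof
    where
    |x∷t₀| : length (x ∷ t₀) ≡ length gb
    |x∷t₀| = ≡.trans (≡.sym (length-∷ʳ t₀ y)) |t|
    |remainder| : length ((x ∷ t₀) ⊞ map (- y *_) gb) ≡ length gb
    |remainder| = ≡.trans (length-⊞-≡ (x ∷ t₀) (map (- y *_) gb) (≡.trans |x∷t₀| (≡.sym (Listₚ.length-map _ gb)))) |x∷t₀|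
    proof : ∀ b n → act (x ∷ p) b n ≈ act (y ∷ s) (act (gb ∷ʳ 1#) b) n + act ((x ∷ t₀) ⊞ map (- y *_) gb) b n
    proof b n = begin
      x * b n + act p b (suc n)                                 ≈⟨ +-cong refl (eq b (suc n)) ⟩
      x * b n + (S + act (t₀ ∷ʳ y) b (suc n))                   ≈⟨ +-cong refl (+-cong refl (act-∷ʳ t₀ y b (suc n))) ⟩
      x * b n + (S + (T + y * b (suc n ℕ.+ length t₀)))         ≡⟨ ≡.cong (λ i → x * b n + (S + (T + y * b i))) top-index ⟩
      x * b n + (S + (T + y * B))                               ≈⟨ rearrange (x * b n) S T (y * B) (y * A) ⟩
      (y * A + (y * B + S)) + ((x * b n + T) + - (y * A))       ≈⟨ +-cong (solve 4 (λ y A B S → y :* A :+ (y :* B :+ S) := y :* (A :+ B) :+ S) refl y A B S)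
                                                                          (+-cong refl (-‿distribˡ-* y A)) ⟩
      (y * (A + B) + S) + ((x * b n + T) + - y * A)
        ≈⟨ +-cong (+-cong (*-cong refl (trans (+-cong refl (sym (*-identityˡ B))) (sym (act-∷ʳ gb 1# b n)))) refl)
                                                                          (trans (+-cong refl (sym (act-scale gb (- y) b n))) (sym (act-⊞ (x ∷ t₀) (map (- y *_) gb) b n))) ⟩
      act (y ∷ s) (act (gb ∷ʳ 1#) b) n + act ((x ∷ t₀) ⊞ map (- y *_) gb) b n ∎
      where
      S T A B : F
      S = act s (act (gb ∷ʳ 1#) b) (suc n)
      T = act t₀ b (suc n)
      A = act gb b n
      B = b (n ℕ.+ length gb)
      top-index : suc n ℕ.+ length t₀ ≡ n ℕ.+ length gb
      top-index = ≡.trans (≡.sym (ℕₚ.+-suc n (length t₀))) (≡.cong (n ℕ.+_) |x∷t₀|)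

  divide : ∀ gb p → Division gb p
  divide gb []      = division [] (replicate (length gb) 0#) (Listₚ.length-replicate _)
                        (λ b n → sym (trans (+-identityˡ _) (act-replicate-0 (length gb) b n)))
  divide gb (x ∷ p) = divide-∷ gb x (divide gb p)

  AnnihilatesFrom : ℕ → Poly R → Seq → Set ℓ
  AnnihilatesFrom N p a = ∀ n → N ≤ n → act p a n ≈ 0#

  annihilatesFrom-resp-≅ : ∀ {p q N a} → p ≅ q → AnnihilatesFrom N p a → AnnihilatesFrom N q a
  annihilatesFrom-resp-≅ {a = a} p≅q h n N≤n = trans (sym (p≅q a n)) (h n N≤n)

  annihilatesFrom-⊠ʳ : ∀ p q {N a} → AnnihilatesFrom N q a → AnnihilatesFrom N (p ⊠ q) a
  annihilatesFrom-⊠ʳ p q {a = a} h n N≤n =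
    trans (act-⊠ p q a n) (act-vanishing p (λ i _ → h (n ℕ.+ i) (ℕₚ.≤-trans N≤n (ℕₚ.m≤m+n n i))))

  annihilatesFrom-∣ₚ : ∀ {g p N a} → _∣ₚ_ R g p → AnnihilatesFrom N g a → AnnihilatesFrom N p a
  annihilatesFrom-∣ₚ {g} {p} {a = a} (u , g⊠u≈p) h =
    annihilatesFrom-resp-≅ {u ⊠ g} {p} u⊠g≅p (annihilatesFrom-⊠ʳ u g h)
    where
    u⊠g≅p : u ⊠ g ≅ p
    u⊠g≅p b n = begin
      act (u ⊠ g) b n   ≈⟨ act-⊠ u g b n ⟩
      act u (act g b) n ≈⟨ sym (act-comm g u b n) ⟩
      act g (act u b) n ≈⟨ sym (act-⊠ g u b n) ⟩
      act (g ⊠ u) b n   ≈⟨ ≈ₚ⇒≅ {g ⊠ u} {p} g⊠u≈p b n ⟩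
      act p b n         ∎

  monic-divides : ∀ gb p a N → AnnihilatesFrom N (gb ∷ʳ 1#) a → AnnihilatesFrom N p a →
                  (∀ t → length t ≡ length gb → AnnihilatesFrom N t a → t ≅ []) →
                  _∣ₚ_ R (gb ∷ʳ 1#) p
  monic-divides gb p a N G-ann p-ann short = s , ≅⇒≈ₚ {G ⊠ s} {p} G⊠s≅p
    where
    open Division (divide gb p) renaming (quotient to s; remainder to t)
    G : Poly R
    G = gb ∷ʳ 1#
    t-ann : AnnihilatesFrom N t a
    t-ann n N≤n = begin
      act t a n                       ≈⟨ sym (+-identityˡ _) ⟩
      0# + act t a n                  ≈⟨ +-cong (sym (annihilatesFrom-⊠ʳ s G G-ann n N≤n)) refl ⟩
      act (s ⊠ G) a n + act t a n     ≈⟨ +-cong (act-⊠ s G a n) refl ⟩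
      act s (act G a) n + act t a n   ≈⟨ sym (act-division a n) ⟩
      act p a n                       ≈⟨ p-ann n N≤n ⟩
      0#                              ∎
    G⊠s≅p : G ⊠ s ≅ p
    G⊠s≅p b n = begin
      act (G ⊠ s) b n                 ≈⟨ act-⊠ G s b n ⟩
      act G (act s b) n               ≈⟨ act-comm G s b n ⟩
      act s (act G b) n               ≈⟨ sym (+-identityʳ _) ⟩
      act s (act G b) n + 0#          ≈⟨ +-cong refl (sym (short t length-remainder t-ann b n)) ⟩
      act s (act G b) n + act t b n   ≈⟨ sym (act-division b n) ⟩
      act p b n                       ∎

  zero-top⇒≅[] : ∀ {N a d} → (∀ t x → length t < d → AnnihilatesFrom N (t ∷ʳ x) a → x ≈ 0#) →
                 ∀ t → length t ≤ d → AnnihilatesFrom N t a → t ≅ []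
  zero-top⇒≅[] {N} {a} {d} zero-top t = go (reverseView t)
    where
    go : ∀ {t} → Reverse t → length t ≤ d → AnnihilatesFrom N t a → t ≅ []
    go []              _   _   b n = refl
    go (t ∶ rest ∶ʳ x) |t| ann b n = trans (∷ʳ0≅ t x≈0 b n) (go rest (ℕₚ.<⇒≤ |t|<d) t-ann b n)
      where
      |t|<d : length t < d
      |t|<d = ℕₚ.≤-trans (ℕₚ.≤-reflexive (≡.sym (length-∷ʳ t x))) |t|
      x≈0 : x ≈ 0#
      x≈0 = zero-top t x |t|<d ann
      t-ann : AnnihilatesFrom N t a
      t-ann = annihilatesFrom-resp-≅ {t ∷ʳ x} {t} (∷ʳ0≅ t x≈0) ann

module EventuallyPeriodic {c ℓ : Level} (R : CommutativeRing c ℓ) (a : ℕ → CommutativeRing.Carrier R) (N m′ : ℕ)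
                          (periodic : ∀ n → N ≤ n → CommutativeRing._≈_ R (a (n ℕ.+ suc m′)) (a n)) where
  open CommutativeRing R renaming (Carrier to F)
  open PolynomialAction R
  open import Relation.Binary.Reasoning.Setoid (CommutativeRing.setoid R)

  m : ℕ
  m = suc m′

  act-periodic : ∀ p n → N ≤ n → act p a (n ℕ.+ m) ≈ act p a n
  act-periodic p n N≤n = act-local p λ i _ → trans
    (reflexive (≡.cong a (≡.trans (ℕₚ.+-assoc n m i) (≡.trans (≡.cong (n ℕ.+_) (ℕₚ.+-comm m i)) (≡.sym (ℕₚ.+-assoc n i m))))))
    (periodic (n ℕ.+ i) (ℕₚ.≤-trans N≤n (ℕₚ.m≤m+n n i)))

  act-periodic* : ∀ p t n → N ≤ n → act p a (n ℕ.+ t ℕ.* m) ≈ act p a n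
  act-periodic* p zero    n N≤n = reflexive (≡.cong (act p a) (ℕₚ.+-identityʳ n))
  act-periodic* p (suc t) n N≤n = begin
    act p a (n ℕ.+ (m ℕ.+ t ℕ.* m))   ≡⟨ ≡.cong (act p a) (≡.sym (ℕₚ.+-assoc n m (t ℕ.* m))) ⟩
    act p a (n ℕ.+ m ℕ.+ t ℕ.* m)     ≈⟨ act-periodic* p t (n ℕ.+ m) (ℕₚ.≤-trans N≤n (ℕₚ.m≤m+n n m)) ⟩
    act p a (n ℕ.+ m)                 ≈⟨ act-periodic p n N≤n ⟩
    act p a n                         ∎

  window⇒annihilatesFrom : ∀ p → (∀ (j : Fin m) → act p a (N ℕ.+ toℕ j) ≈ 0#) → AnnihilatesFrom N p a
  window⇒annihilatesFrom p window n N≤n = begin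
    act p a n                                          ≡⟨ ≡.cong (act p a) n≡ ⟩
    act p a (N ℕ.+ toℕ j ℕ.+ (n ℕ.∸ N) / m ℕ.* m)   ≈⟨ act-periodic* p ((n ℕ.∸ N) / m) (N ℕ.+ toℕ j) (ℕₚ.m≤m+n N _) ⟩
    act p a (N ℕ.+ toℕ j)                              ≈⟨ window j ⟩
    0#                                                 ∎
    where
    j : Fin m
    j = Fin.fromℕ< (m%n<n (n ℕ.∸ N) m)
    n≡ : n ≡ N ℕ.+ toℕ j ℕ.+ (n ℕ.∸ N) / m ℕ.* m
    n≡ = ≡.trans (≡.sym (ℕₚ.m+[n∸m]≡n N≤n))
           (≡.trans (≡.cong (N ℕ.+_) (≡.trans (m≡m%n+[m/n]*n (n ℕ.∸ N) m)
                                               (≡.cong (ℕ._+ (n ℕ.∸ N) / m ℕ.* m) (≡.sym (Finₚ.toℕ-fromℕ< _)))))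
                    (≡.sym (ℕₚ.+-assoc N (toℕ j) ((n ℕ.∸ N) / m ℕ.* m))))

  annihilatesFrom? : Decidable _≈_ → ∀ p → Dec (AnnihilatesFrom N p a)
  annihilatesFrom? _≟_ p with Finₚ.all? (λ (j : Fin m) → act p a (N ℕ.+ toℕ j) ≟ 0#)
  ... | yes window = yes (window⇒annihilatesFrom p window)
  ... | no ¬window = no λ ann → ¬window λ j → ann (N ℕ.+ toℕ j) (ℕₚ.m≤m+n N _)

  annihilatesFrom-drop-coef₀ : ∀ p → coef p 0 ≈ 0# → AnnihilatesFrom N p a → AnnihilatesFrom N (List.drop 1 p) a
  annihilatesFrom-drop-coef₀ p p₀≈0 ann n N≤n = begin
    act (List.drop 1 p) a n           ≈⟨ sym (act-periodic (List.drop 1 p) n N≤n) ⟩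
    act (List.drop 1 p) a (n ℕ.+ m)   ≡⟨ ≡.cong (act (List.drop 1 p) a) (ℕₚ.+-suc n m′) ⟩
    act (List.drop 1 p) a (suc (n ℕ.+ m′)) ≈⟨ sym (act-coef₀≈0 p p₀≈0 a (n ℕ.+ m′)) ⟩
    act p a (n ℕ.+ m′)                ≈⟨ ann (n ℕ.+ m′) (ℕₚ.≤-trans N≤n (ℕₚ.m≤m+n n m′)) ⟩
    0#                                ∎

-- The impulse response of the monic polynomial gb ∷ʳ 1# of degree e + 1:
-- the solution of its recurrence with initial values 0, …, 0, 1.
module ImpulseResponse {c ℓ : Level} (R : CommutativeRing c ℓ)
                       (e : ℕ) (gb : Poly R) (|gb| : length gb ≡ suc e) where
  open CommutativeRing R renaming (Carrier to F)
  open PolynomialAction R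
  open import Relation.Binary.Reasoning.Setoid (CommutativeRing.setoid R)

  next : Poly R → Poly R
  next []       = []
  next (s₀ ∷ s) = s ∷ʳ (- act gb (coef (s₀ ∷ s)) 0)

  -- window n = [ impulse n , … , impulse (n + e) ]
  window : ℕ → Poly R
  window zero    = replicate e 0# ∷ʳ 1#
  window (suc n) = next (window n)

  impulse : Seq
  impulse n = coef (window n) 0

  length-window : ∀ n → length (window n) ≡ suc e
  length-window zero    = ≡.trans (length-∷ʳ (replicate e 0#) 1#) (≡.cong suc (Listₚ.length-replicate e))
  length-window (suc n) with window n | length-window n
  ... | s₀ ∷ s | |s₀∷s| = ≡.trans (length-∷ʳ s _) |s₀∷s|

  coef-next : ∀ s → length s ≡ suc e → ∀ {i} → i < e → coef (next s) i ≡ coef s (suc i)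
  coef-next (s₀ ∷ s) |s| i<e = coef-∷ʳ-< s _ (ℕₚ.≤-trans i<e (ℕₚ.≤-reflexive (≡.sym (ℕₚ.suc-injective |s|))))

  coef-next-last : ∀ s → length s ≡ suc e → coef (next s) e ≡ - act gb (coef s) 0
  coef-next-last (s₀ ∷ s) |s| = ≡.subst (λ j → coef (next (s₀ ∷ s)) j ≡ _) (ℕₚ.suc-injective |s|) (coef-∷ʳ s _)

  coef-window : ∀ n {i} → i ≤ e → coef (window n) i ≡ impulse (n ℕ.+ i)
  coef-window n {zero}  _       = ≡.cong impulse (≡.sym (ℕₚ.+-identityʳ n))
  coef-window n {suc i} i<e =
    ≡.trans (≡.sym (coef-next (window n) (length-window n) i<e))
            (≡.trans (coef-window (suc n) (ℕₚ.<⇒≤ i<e)) (≡.cong impulse (≡.sym (ℕₚ.+-suc n i))))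

  impulse-annihilated : ∀ n → act (gb ∷ʳ 1#) impulse n ≈ 0#
  impulse-annihilated n = begin
    act (gb ∷ʳ 1#) impulse n                         ≈⟨ act-∷ʳ gb 1# impulse n ⟩
    act gb impulse n + 1# * impulse (n ℕ.+ length gb) ≈⟨ +-cong refl (*-identityˡ _) ⟩
    act gb impulse n + impulse (n ℕ.+ length gb)      ≡⟨ ≡.cong (act gb impulse n +_) last ⟩
    act gb impulse n + - act gb (coef (window n)) 0   ≈⟨ +-cong refl (-‿cong (act-local gb window≈impulse)) ⟩
    act gb impulse n + - act gb impulse n             ≈⟨ -‿inverseʳ _ ⟩
    0#                                                ∎
    where
    last : impulse (n ℕ.+ length gb) ≡ - act gb (coef (window n)) 0
    last = ≡.trans (≡.cong impulse (≡.trans (≡.cong (n ℕ.+_) |gb|) (ℕₚ.+-suc n e)))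
                   (≡.trans (≡.sym (coef-window (suc n) ℕₚ.≤-refl)) (coef-next-last (window n) (length-window n)))
    window≈impulse : ∀ i → i < length gb → coef (window n) (0 ℕ.+ i) ≈ impulse (n ℕ.+ i)
    window≈impulse i i< = reflexive (coef-window n (ℕₚ.≤-pred (ℕₚ.≤-trans i< (ℕₚ.≤-reflexive |gb|))))

  impulse-initial : ∀ {i} → i < e → impulse i ≡ 0#
  impulse-initial {i} i<e = ≡.trans (≡.sym (coef-window 0 (ℕₚ.<⇒≤ i<e)))
    (≡.trans (coef-∷ʳ-< (replicate e 0#) 1# (ℕₚ.≤-trans i<e (ℕₚ.≤-reflexive (≡.sym (Listₚ.length-replicate e)))))
             (coef-replicate-0 e i))

  impulse-e : impulse e ≡ 1#
  impulse-e = ≡.trans (≡.sym (coef-window 0 ℕₚ.≤-refl))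
    (≡.subst (λ j → coef (window 0) j ≡ 1#) (Listₚ.length-replicate e) (coef-∷ʳ (replicate e 0#) 1#))

  -- Evaluating t ∷ʳ x at e ∸ length t sees only the initial values 0, …, 0, 1.
  impulse-no-short-annihilator : ∀ t → length t ≤ suc e → AnnihilatesFrom 0 t impulse → t ≅ []
  impulse-no-short-annihilator = zero-top⇒≅[] zero-top
    where
    zero-top : ∀ t x → length t < suc e → AnnihilatesFrom 0 (t ∷ʳ x) impulse → x ≈ 0#
    zero-top t x (s≤s |t|≤e) ann = begin
      x                                       ≈⟨ sym (*-identityʳ x) ⟩
      x * 1#                                  ≡⟨ ≡.cong (x *_) (≡.sym (≡.trans (≡.cong impulse n₀+|t|) impulse-e)) ⟩
      x * impulse (n₀ ℕ.+ length t)           ≈⟨ sym (+-identityˡ _) ⟩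
      0# + x * impulse (n₀ ℕ.+ length t)      ≈⟨ +-cong (sym (act-vanishing t below)) refl ⟩
      act t impulse n₀ + x * impulse (n₀ ℕ.+ length t) ≈⟨ sym (act-∷ʳ t x impulse n₀) ⟩
      act (t ∷ʳ x) impulse n₀                 ≈⟨ ann n₀ z≤n ⟩
      0#                                      ∎
      where
      n₀ : ℕ
      n₀ = e ℕ.∸ length t
      n₀+|t| : n₀ ℕ.+ length t ≡ e
      n₀+|t| = ℕₚ.m∸n+n≡m |t|≤e
      below : ∀ i → i < length t → impulse (n₀ ℕ.+ i) ≈ 0#
      below i i< = reflexive (impulse-initial (ℕₚ.<-≤-trans (ℕₚ.+-monoʳ-< n₀ i<) (ℕₚ.≤-reflexive n₀+|t|)))

module MonicAnnihilators {c ℓ : Level} (R : CommutativeRing c ℓ) where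
  open CommutativeRing R renaming (Carrier to F)
  open PolynomialAction R
  open import Relation.Binary.Reasoning.Setoid (CommutativeRing.setoid R)

  impulse-response : ∀ gb → Σ Seq λ a → (∀ n → act (gb ∷ʳ 1#) a n ≈ 0#) ×
                     (∀ t → length t ≤ length gb → AnnihilatesFrom 0 t a → t ≅ [])
  impulse-response []         = (λ _ → 0#) , act-[1] (λ _ → 0#) ,
                                λ { [] _ _ b n → refl }
  impulse-response gb@(_ ∷ _) = impulse , impulse-annihilated , impulse-no-short-annihilator
    where open ImpulseResponse R (ℕ.pred (length gb)) gb ≡.refl

  -- H = (x^j + 1)(gb ∷ʳ 1#) with j = k + 1 − length gb, except H = gb ∷ʳ 1# when j = 0
  -- (x^0 + 1 = 2 may vanish).
  monic-multiple-of-degree : ∀ k gb → length gb ≤ suc k → ¬ (coef (gb ∷ʳ 1#) 0 ≈ 0#) →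
    Σ (Poly R) λ H → length H ≤ suc (suc k) × coef H (suc k) ≈ 1# × ¬ (coef H 0 ≈ 0#) ×
                     (∀ b → (∀ n → act (gb ∷ʳ 1#) b n ≈ 0#) → ∀ n → act H b n ≈ 0#)
  monic-multiple-of-degree k gb |gb|≤ G₀≉0 = go (suc k ℕ.∸ length gb) (ℕₚ.m∸n+n≡m |gb|≤)
    where
    G : Poly R
    G = gb ∷ʳ 1#
    d : ℕ
    d = length gb
    |G| : length G ≡ suc d
    |G| = length-∷ʳ gb 1#
    go : ∀ j → j ℕ.+ d ≡ suc k → Σ (Poly R) λ H → length H ≤ suc (suc k) × coef H (suc k) ≈ 1# ×
           ¬ (coef H 0 ≈ 0#) × (∀ b → (∀ n → act G b n ≈ 0#) → ∀ n → act H b n ≈ 0#)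
    go zero    d≡ = G , ℕₚ.≤-reflexive (≡.trans |G| (≡.cong suc d≡)) ,
                    reflexive (≡.subst (λ i → coef G i ≡ 1#) d≡ (coef-∷ʳ gb 1#)) , G₀≉0 , λ b ann → ann
    go (suc j) j+d≡   = shiftₚ (suc j) G ⊞ G , |H| , H-top , H₀≉0 , H-ann
      where
      |shiftG| : length (shiftₚ (suc j) G) ≡ suc (suc k)
      |shiftG| = ≡.trans (length-shiftₚ (suc j) G) (≡.trans (≡.cong (suc j ℕ.+_) |G|)
                   (≡.trans (ℕₚ.+-suc (suc j) d) (≡.cong suc j+d≡)))
      d<suc-k : d < suc k
      d<suc-k = ℕₚ.≤-trans (s≤s (ℕₚ.m≤n+m d j)) (ℕₚ.≤-reflexive j+d≡)
      |H| : length (shiftₚ (suc j) G ⊞ G) ≤ suc (suc k)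
      |H| = length-⊞ (shiftₚ (suc j) G) G (ℕₚ.≤-reflexive |shiftG|)
                     (ℕₚ.≤-trans (ℕₚ.≤-reflexive |G|) (ℕₚ.m≤n⇒m≤1+n d<suc-k))
      H-top : coef (shiftₚ (suc j) G ⊞ G) (suc k) ≈ 1#
      H-top = begin
        coef (shiftₚ (suc j) G ⊞ G) (suc k)             ≈⟨ coef-⊞ (shiftₚ (suc j) G) G (suc k) ⟩
        coef (shiftₚ (suc j) G) (suc k) + coef G (suc k) ≡⟨ ≡.cong₂ _+_ shift-top
                                                              (coef-beyond G (ℕₚ.≤-trans (ℕₚ.≤-reflexive |G|) d<suc-k)) ⟩
        1# + 0#                                           ≈⟨ +-identityʳ 1# ⟩
        1#                                                ∎
        where
        shift-top : coef (shiftₚ (suc j) G) (suc k) ≡ 1#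
        shift-top = ≡.subst (λ i → coef (shiftₚ (suc j) G) i ≡ 1#) j+d≡
                      (≡.trans (coef-shiftₚ (suc j) G d) (coef-∷ʳ gb 1#))
      H₀≉0 : ¬ (coef (shiftₚ (suc j) G ⊞ G) 0 ≈ 0#)
      H₀≉0 H₀≈0 = G₀≉0 (trans (sym (+-identityˡ _)) (trans (sym (coef-⊞ (shiftₚ (suc j) G) G 0)) H₀≈0))
      H-ann : ∀ b → (∀ n → act G b n ≈ 0#) → ∀ n → act (shiftₚ (suc j) G ⊞ G) b n ≈ 0#
      H-ann b ann n = trans (act-⊞ (shiftₚ (suc j) G) G b n)
        (trans (+-cong (trans (act-shiftₚ (suc j) G b n) (ann _)) (ann n)) (+-identityʳ 0#))

module FieldLemmas {c ℓ : Level} (R : CommutativeRing c ℓ) (isField : IsField R) where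
  open CommutativeRing R renaming (Carrier to F)
  open PolynomialAction R
  open import Relation.Binary.Reasoning.Setoid (CommutativeRing.setoid R)
  open import Algebra.Properties.Ring ring using (-0#≈0#)
  open import Algebra.Properties.Group +-group using (⁻¹-injective)
  open import Algebra.Solver.Ring.NaturalCoefficients.Default commutativeSemiring
    using (solve; _:=_; _:+_; _:*_)

  1≉0 : ¬ (1# ≈ 0#)
  1≉0 = proj₁ isField

  inverse : (x : F) → ¬ (x ≈ 0#) → F
  inverse x x≉0 = proj₁ (proj₂ isField x x≉0)

  inverseˡ : ∀ x (x≉0 : ¬ (x ≈ 0#)) → inverse x x≉0 * x ≈ 1#
  inverseˡ x x≉0 = trans (*-comm _ _) (proj₂ (proj₂ isField x x≉0))

  x*y≈0⇒y≈0 : ∀ {x y} → ¬ (x ≈ 0#) → x * y ≈ 0# → y ≈ 0#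
  x*y≈0⇒y≈0 {x} {y} x≉0 xy≈0 = begin
    y                         ≈⟨ sym (*-identityˡ y) ⟩
    1# * y                    ≈⟨ *-cong (sym (inverseˡ x x≉0)) refl ⟩
    inverse x x≉0 * x * y     ≈⟨ *-assoc _ _ _ ⟩
    inverse x x≉0 * (x * y)   ≈⟨ *-cong refl xy≈0 ⟩
    inverse x x≉0 * 0#        ≈⟨ zeroʳ _ ⟩
    0#                        ∎

  ∣X^-1⇒coef₀≉0 : ∀ {g} m → _∣ₚ_ R g (X^-1 R (suc m)) → ¬ (coef g 0 ≈ 0#)
  ∣X^-1⇒coef₀≉0 {g} m (u , g⊠u≈X^-1) g₀≈0 = 1≉0 (⁻¹-injective (begin
    - 1#                      ≈⟨ sym (+-identityˡ _) ⟩
    coef (X^ R (suc m)) 0 + - 1# ≈⟨ sym (coef-⊞ (X^ R (suc m)) [ - 1# ] 0) ⟩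
    coef (X^-1 R (suc m)) 0   ≈⟨ sym (g⊠u≈X^-1 0) ⟩
    coef (g ⊠ u) 0            ≈⟨ coef-⊠-0 g u ⟩
    coef g 0 * coef u 0       ≈⟨ *-cong g₀≈0 refl ⟩
    0# * coef u 0             ≈⟨ zeroˡ _ ⟩
    0#                        ≈⟨ sym -0#≈0# ⟩
    - 0#                      ∎))

  -- A common divisor d has d(0) ≠ 0, so d · u = x forces u(0) = 0 and d · (u / x) = 1.
  coef₀≉0⇒coprime-X : ∀ g → ¬ (coef g 0 ≈ 0#) → CoprimeP R g (X^ R 1)
  coef₀≉0⇒coprime-X g g₀≉0 d (v , d⊠v≈g) (u , d⊠u≈X) = u' , ≅⇒≈ₚ {d ⊠ u'} {[ 1# ]} d⊠u'≅1
    where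
    u' : Poly R
    u' = List.drop 1 u
    d₀≉0 : ¬ (coef d 0 ≈ 0#)
    d₀≉0 d₀≈0 = g₀≉0 (begin
      coef g 0              ≈⟨ sym (d⊠v≈g 0) ⟩
      coef (d ⊠ v) 0        ≈⟨ coef-⊠-0 d v ⟩
      coef d 0 * coef v 0   ≈⟨ *-cong d₀≈0 refl ⟩
      0# * coef v 0         ≈⟨ zeroˡ _ ⟩
      0#                    ∎)
    u₀≈0 : coef u 0 ≈ 0#
    u₀≈0 = x*y≈0⇒y≈0 d₀≉0 (trans (sym (coef-⊠-0 d u)) (d⊠u≈X 0))
    d⊠u'≅1 : d ⊠ u' ≅ [ 1# ]
    d⊠u'≅1 = ≈ₚ⇒≅ {d ⊠ u'} {[ 1# ]} λ i → begin
      coef (d ⊠ u') i                   ≈⟨ sym (act-δ (d ⊠ u') i) ⟩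
      act (d ⊠ u') (δ i) 0              ≈⟨ act-⊠ d u' (δ i) 0 ⟩
      act d (act u' (δ i)) 0            ≈⟨ act-cong d (λ j → trans (reflexive (act-suc u' (δ (suc i)) j)) (sym (act-coef₀≈0 u u₀≈0 (δ (suc i)) j))) ⟩
      act d (act u (δ (suc i))) 0       ≈⟨ sym (act-⊠ d u (δ (suc i)) 0) ⟩
      act (d ⊠ u) (δ (suc i)) 0         ≈⟨ act-δ (d ⊠ u) (suc i) ⟩
      coef (d ⊠ u) (suc i)              ≈⟨ d⊠u≈X (suc i) ⟩
      coef [ 1# ] i                     ∎

  -- G₀ z N = − Σ_{i≥1} Gᵢ z (N + i), so zeros propagate backwards from the tail.
  eventually-zero⇒zero : ∀ G (z : Seq) → ¬ (coef G 0 ≈ 0#) → (∀ n → act G z n ≈ 0#) →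
                         ∀ N → (∀ n → N ≤ n → z n ≈ 0#) → ∀ n → z n ≈ 0#
  eventually-zero⇒zero []       z G₀≉0 _   _       _    = ⊥-elim (G₀≉0 refl)
  eventually-zero⇒zero (G₀ ∷ G) z G₀≉0 ann zero    vanish n = vanish n z≤n
  eventually-zero⇒zero (G₀ ∷ G) z G₀≉0 ann (suc N) vanish = eventually-zero⇒zero (G₀ ∷ G) z G₀≉0 ann N vanish′
    where
    zN : z N ≈ 0#
    zN = x*y≈0⇒y≈0 G₀≉0 (begin
      G₀ * z N                  ≈⟨ sym (+-identityʳ _) ⟩
      G₀ * z N + 0#             ≈⟨ +-cong refl (sym (act-vanishing G (λ i _ → vanish (suc N ℕ.+ i) (ℕₚ.m≤m+n (suc N) i)))) ⟩
      G₀ * z N + act G z (suc N) ≈⟨ ann N ⟩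
      0#                        ∎)
    vanish′ : ∀ n → N ≤ n → z n ≈ 0#
    vanish′ n N≤n with ℕₚ.m≤n⇒m<n∨m≡n N≤n
    ... | inj₁ N<n    = vanish n N<n
    ... | inj₂ ≡.refl = zN

  monic : (gb : Poly R) (x : F) → ¬ (x ≈ 0#) → Poly R
  monic gb x x≉0 = map (inverse x x≉0 *_) gb ∷ʳ 1#

  act-monic : ∀ gb x (x≉0 : ¬ (x ≈ 0#)) b n → act (gb ∷ʳ x) b n ≈ x * act (monic gb x x≉0) b n
  act-monic gb x x≉0 b n = begin
    act (gb ∷ʳ x) b n                              ≈⟨ act-∷ʳ gb x b n ⟩
    act gb b n + x * B                             ≈⟨ +-cong (sym (trans (*-cong (trans (*-comm _ _) (inverseˡ x x≉0)) refl) (*-identityˡ _))) refl ⟩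
    x * x⁻¹ * act gb b n + x * B                   ≈⟨ solve 4 (λ x y A B → x :* y :* A :+ x :* B := x :* (y :* A :+ B)) refl x x⁻¹ (act gb b n) B ⟩
    x * (x⁻¹ * act gb b n + B)                     ≈⟨ *-cong refl (+-cong (sym (act-scale gb x⁻¹ b n)) (sym (*-identityˡ B))) ⟩
    x * (act (map (x⁻¹ *_) gb) b n + 1# * B)       ≡⟨ ≡.cong (λ i → x * (act (map (x⁻¹ *_) gb) b n + 1# * b (n ℕ.+ i))) (≡.sym (Listₚ.length-map _ gb)) ⟩
    x * (act (map (x⁻¹ *_) gb) b n + 1# * b (n ℕ.+ length (map (x⁻¹ *_) gb))) ≈⟨ *-cong refl (sym (act-∷ʳ (map (x⁻¹ *_) gb) 1# b n)) ⟩
    x * act (monic gb x x≉0) b n                   ∎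
    where
    x⁻¹ B : F
    x⁻¹ = inverse x x≉0
    B = b (n ℕ.+ length gb)

  ∣ₚ-monic⇒∣ₚ : ∀ {g p} gb x (x≉0 : ¬ (x ≈ 0#)) → g ≅ gb ∷ʳ x → _∣ₚ_ R (monic gb x x≉0) p → _∣ₚ_ R g p
  ∣ₚ-monic⇒∣ₚ {g} {p} gb x x≉0 g≅ (s , G⊠s≈p) = u , ≅⇒≈ₚ {g ⊠ u} {p} g⊠u≅p
    where
    G u : Poly R
    G = monic gb x x≉0
    u = map (inverse x x≉0 *_) s
    g⊠u≅p : g ⊠ u ≅ p
    g⊠u≅p b n = begin
      act (g ⊠ u) b n                         ≈⟨ act-⊠ g u b n ⟩
      act g (act u b) n                       ≈⟨ g≅ (act u b) n ⟩
      act (gb ∷ʳ x) (act u b) n               ≈⟨ act-monic gb x x≉0 (act u b) n ⟩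
      x * act G (act u b) n                   ≈⟨ *-cong refl (act-comm G u b n) ⟩
      x * act u (act G b) n                   ≈⟨ *-cong refl (act-scale s (inverse x x≉0) (act G b) n) ⟩
      x * (inverse x x≉0 * act s (act G b) n) ≈⟨ sym (*-assoc _ _ _) ⟩
      x * inverse x x≉0 * act s (act G b) n   ≈⟨ *-cong (trans (*-comm _ _) (inverseˡ x x≉0)) refl ⟩
      1# * act s (act G b) n                  ≈⟨ *-identityˡ _ ⟩
      act s (act G b) n                       ≈⟨ sym (act-comm G s b n) ⟩
      act G (act s b) n                       ≈⟨ sym (act-⊠ G s b n) ⟩
      act (G ⊠ s) b n                         ≈⟨ ≈ₚ⇒≅ {G ⊠ s} {p} G⊠s≈p b n ⟩
      act p b n                               ∎

  leading-term : Decidable _≈_ → ∀ g → ¬ (_≈ₚ_ R g []) →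
                 Σ (Poly R) λ gb → Σ F λ x → ¬ (x ≈ 0#) × g ≅ gb ∷ʳ x
  leading-term _≟_ g = go (reverseView g)
    where
    go : ∀ {g} → Reverse g → ¬ (_≈ₚ_ R g []) → Σ (Poly R) λ gb → Σ F λ x → ¬ (x ≈ 0#) × g ≅ gb ∷ʳ x
    go []            g≉0 = ⊥-elim (g≉0 (λ _ → refl))
    go (g ∶ rest ∶ʳ x) g≉0 with x ≟ 0#
    ... | no  x≉0 = g , x , x≉0 , λ b n → refl
    ... | yes x≈0 with go rest (λ g≈0 → g≉0 (λ i → trans (≅⇒≈ₚ {g ∷ʳ x} {g} (∷ʳ0≅ g x≈0) i) (g≈0 i)))
    ...   | gb , y , y≉0 , g≅ = gb , y , y≉0 , λ b n → trans (∷ʳ0≅ g x≈0 b n) (g≅ b n)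

  monic-coef₀≉0 : ∀ {g} gb x (x≉0 : ¬ (x ≈ 0#)) → g ≅ gb ∷ʳ x → ¬ (coef g 0 ≈ 0#) →
                  ¬ (coef (monic gb x x≉0) 0 ≈ 0#)
  monic-coef₀≉0 {g} gb x x≉0 g≅ g₀≉0 G₀≈0 = g₀≉0 (begin
    coef g 0                       ≈⟨ sym (act-δ g 0) ⟩
    act g (δ 0) 0                  ≈⟨ g≅ (δ 0) 0 ⟩
    act (gb ∷ʳ x) (δ 0) 0          ≈⟨ act-monic gb x x≉0 (δ 0) 0 ⟩
    x * act (monic gb x x≉0) (δ 0) 0 ≈⟨ *-cong refl (trans (act-δ (monic gb x x≉0) 0) G₀≈0) ⟩
    x * 0#                         ≈⟨ zeroʳ x ⟩
    0#                             ∎)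

module OrderToPeriod {c ℓ : Level} (R : CommutativeRing c ℓ) (isField : IsField R)
                     (_≟_ : Decidable (CommutativeRing._≈_ R)) where
  open CommutativeRing R renaming (Carrier to F)
  open PolynomialAction R
  open MonicAnnihilators R
  open FieldLemmas R isField
  open import Relation.Binary.Reasoning.Setoid (CommutativeRing.setoid R)

  degree-bound : ∀ k (f : Fin (suc k) → F) r {g} gb x → ¬ (x ≈ 0#) → g ≅ gb ∷ʳ x →
                 _≈ₚ_ R (toPoly R k f) (X^ R r ⊠ g) → length gb ≤ k
  degree-bound k f r {g} gb x x≉0 g≅ f≈X^r⊠g with suc k ℕₚ.≤? r ℕ.+ length gb
  ... | no  k<top = ℕₚ.≤-pred (ℕₚ.≤-trans (s≤s (ℕₚ.m≤n+m (length gb) r)) (ℕₚ.≰⇒> k<top))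
  ... | yes k≥top = ⊥-elim (x≉0 (begin
    x                                      ≡⟨ ≡.sym (coef-∷ʳ gb x) ⟩
    coef (gb ∷ʳ x) (length gb)             ≈⟨ sym (≅⇒≈ₚ {g} {gb ∷ʳ x} g≅ (length gb)) ⟩
    coef g (length gb)                     ≡⟨ ≡.sym (coef-shiftₚ r g (length gb)) ⟩
    coef (shiftₚ r g) (r ℕ.+ length gb)    ≈⟨ sym (≅⇒≈ₚ {X^ R r ⊠ g} {shiftₚ r g} (X^⊠≅shiftₚ r g) (r ℕ.+ length gb)) ⟩
    coef (X^ R r ⊠ g) (r ℕ.+ length gb)    ≈⟨ sym (f≈X^r⊠g (r ℕ.+ length gb)) ⟩
    coef (toPoly R k f) (r ℕ.+ length gb)  ≡⟨ coef-beyond (tabulate f) (ℕₚ.≤-trans (ℕₚ.≤-reflexive (Listₚ.length-tabulate f)) k≥top) ⟩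
    0#                                     ∎))

  order⇒period : ∀ k m → O R (suc k) m → P R (suc k) m
  order⇒period k zero      (_ , _ , _ , _ , _ , _ , () , _)
  order⇒period k (suc m′) (f , _ , r , g , f≈X^r⊠g , _ , _ , g∣X^m-1 , minimal)
    with leading-term _≟_ g (λ g≈0 → ∣X^-1⇒coef₀≉0 {g} m′ g∣X^m-1 (g≈0 0))
  ... | gb , x , x≉0 , g≅ with impulse-response (map (inverse x x≉0 *_) gb)
  ... | a , G-ann , G-no-short =
    a , recurrence , (s≤s z≤n , 0 , λ n _ → annihilated⇒periodic (suc m′) a n (X^m-1-ann n z≤n)) , least
    where
    G : Poly R
    G = monic gb x x≉0
    G₀≉0 : ¬ (coef G 0 ≈ 0#)
    G₀≉0 = monic-coef₀≉0 {g} gb x x≉0 g≅ (∣X^-1⇒coef₀≉0 {g} m′ g∣X^m-1)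
    |gb′|≤k+1 : length (map (inverse x x≉0 *_) gb) ≤ suc k
    |gb′|≤k+1 = ℕₚ.≤-trans (ℕₚ.≤-reflexive (Listₚ.length-map _ gb)) (degree-bound (suc k) f r gb x x≉0 g≅ f≈X^r⊠g)
    X^m-1-ann : AnnihilatesFrom 0 (X^-1 R (suc m′)) a
    X^m-1-ann = annihilatesFrom-∣ₚ {g} {X^-1 R (suc m′)} g∣X^m-1 λ n _ →
      trans (g≅ a n) (trans (act-monic gb x x≉0 a n) (trans (*-cong refl (G-ann n)) (zeroʳ x)))
    recurrence : SatisfiesRecurrence R (suc k) a
    recurrence with monic-multiple-of-degree k (map (inverse x x≉0 *_) gb) |gb′|≤k+1 G₀≉0
    ... | H , |H| , H-top , H₀≉0 , H-ann = annihilator⇒recurrence k H a (H-ann a G-ann) |H| H-top H₀≉0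
    least : ∀ m″ → IsEventualPeriod R a m″ → suc m′ ≤ m″
    least m″ (0<m″ , N , periodic) = minimal m″ 0<m″ (∣ₚ-monic⇒∣ₚ {g} {X^-1 R m″} gb x x≉0 g≅
      (monic-divides (map (inverse x x≉0 *_) gb) (X^-1 R m″) a N (λ n _ → G-ann n)
                     (λ n N≤n → periodic⇒annihilated m″ a n (periodic n N≤n)) short))
      where
      short : ∀ t → length t ≡ length (map (inverse x x≉0 *_) gb) → AnnihilatesFrom N t a → t ≅ []
      short t |t| t-ann = G-no-short t (ℕₚ.≤-reflexive |t|) λ n _ →
        eventually-zero⇒zero G (act t a) G₀≉0 (λ n → trans (act-comm G t a n) (act-vanishing-everywhere t G-ann)) N t-ann n

least-below : ∀ {p} (P : ℕ → Set p) → (∀ n → Dec (P n)) → ∀ n →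
              (∀ e → e < n → ¬ P e) ⊎ ∃[ d ] (d < n × P d × (∀ e → e < d → ¬ P e))
least-below P P? zero    = inj₁ λ _ ()
least-below P P? (suc n) with least-below P P? n
... | inj₂ (d , d<n , Pd , below) = inj₂ (d , ℕₚ.m≤n⇒m≤1+n d<n , Pd , below)
... | inj₁ none with P? n
...   | yes Pn = inj₂ (n , ℕₚ.n<1+n n , Pn , none)
...   | no ¬Pn = inj₁ λ e e≤n Pe → [ (λ e<n → none e e<n Pe) , (λ { ≡.refl → ¬Pn Pe }) ]′
                                   (ℕₚ.m≤n⇒m<n∨m≡n (ℕₚ.≤-pred e≤n))

least-witness : ∀ {p} (P : ℕ → Set p) → (∀ n → Dec (P n)) → ∀ {n} → P n →
                ∃[ d ] (d ≤ n × P d × (∀ e → e < d → ¬ P e))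
least-witness P P? {n} Pn with least-below P P? n
... | inj₁ none                     = n , ℕₚ.≤-refl , Pn , none
... | inj₂ (d , d<n , Pd , below)   = d , ℕₚ.<⇒≤ d<n , Pd , below

module FiniteField {c ℓ : Level} (R : CommutativeRing c ℓ) (q : ℕ)
                   (bij : Bijection (setoid (Fin q)) (CommutativeRing.setoid R)) where
  open CommutativeRing R renaming (Carrier to F)
  open Bijection bij using (to; injective; strictlySurjective)

  _≟_ : Decidable _≈_
  x ≟ y with proj₁ (strictlySurjective x) Finₚ.≟ proj₁ (strictlySurjective y)
  ... | yes eq = yes (trans (sym (proj₂ (strictlySurjective x))) (trans (reflexive (≡.cong to eq)) (proj₂ (strictlySurjective y))))
  ... | no ¬eq = no λ x≈y → ¬eq (injective (trans (proj₂ (strictlySurjective x)) (trans x≈y (sym (proj₂ (strictlySurjective y))))))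

  any-of-length? : ∀ {p} (P : Poly R → Set p) → (∀ xs → Dec (P xs)) →
                   (∀ {xs ys} → Pointwise _≈_ xs ys → P xs → P ys) →
                   ∀ e → Dec (∃[ xs ] (length xs ≡ e × P xs))
  any-of-length? P P? resp zero with P? []
  ... | yes P[] = yes ([] , ≡.refl , P[])
  ... | no ¬P[] = no λ { ([] , _ , P[]) → ¬P[] P[] }
  any-of-length? P P? resp (suc e) with Finₚ.any? (λ i → any-of-length? (λ xs → P (to i ∷ xs)) (λ xs → P? (to i ∷ xs))
                                                                        (λ xs≈ys → resp (refl ∷ xs≈ys)) e)
  ... | yes (i , xs , |xs| , Pxs) = yes (to i ∷ xs , ≡.cong suc |xs| , Pxs)
  ... | no ¬any = no λ { (x ∷ xs , |xs| , Pxs) →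
          ¬any (proj₁ (strictlySurjective x) , xs , ℕₚ.suc-injective |xs| ,
                resp (sym (proj₂ (strictlySurjective x)) ∷ Pointwiseₚ.refl refl) Pxs) }

module PeriodToOrder {c ℓ : Level} (R : CommutativeRing c ℓ) (isField : IsField R) (q : ℕ)
                     (bij : Bijection (setoid (Fin q)) (CommutativeRing.setoid R)) where
  open CommutativeRing R renaming (Carrier to F)
  open PolynomialAction R
  open FieldLemmas R isField
  open FiniteField R q bij using (_≟_; any-of-length?)
  open import Relation.Binary.Reasoning.Setoid (CommutativeRing.setoid R)

  -- The monic polynomial of least degree annihilating a from N on, found by exhaustive search
  -- below the degree K of a known monic annihilator hb ∷ʳ 1#.
  module MinimalPolynomial (a : Seq) (N m′ : ℕ) (periodic : ∀ n → N ≤ n → a (n ℕ.+ suc m′) ≈ a n)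
                           (K : ℕ) (hb : Poly R) (|hb| : length hb ≡ K)
                           (hb-ann : AnnihilatesFrom N (hb ∷ʳ 1#) a) where
    open EventuallyPeriodic R a N m′ periodic

    MonicAnnihilator : ℕ → Set (c ⊔ ℓ)
    MonicAnnihilator e = ∃[ gb ] (length gb ≡ e × AnnihilatesFrom N (gb ∷ʳ 1#) a)

    monicAnnihilator? : ∀ e → Dec (MonicAnnihilator e)
    monicAnnihilator? = any-of-length? (λ gb → AnnihilatesFrom N (gb ∷ʳ 1#) a) (λ gb → annihilatesFrom? _≟_ (gb ∷ʳ 1#))
      λ {xs} {ys} xs≈ys → annihilatesFrom-resp-≅ {xs ∷ʳ 1#} {ys ∷ʳ 1#} (Pointwise⇒≅ (++⁺ xs≈ys (refl ∷ [])))

    least : ∃[ d ] (d ≤ K × MonicAnnihilator d × (∀ e → e < d → ¬ MonicAnnihilator e))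
    least = least-witness MonicAnnihilator monicAnnihilator? (hb , |hb| , hb-ann)

    d : ℕ
    d = proj₁ least

    d≤K : d ≤ K
    d≤K = proj₁ (proj₂ least)

    gb : Poly R
    gb = proj₁ (proj₁ (proj₂ (proj₂ least)))

    |gb| : length gb ≡ d
    |gb| = proj₁ (proj₂ (proj₁ (proj₂ (proj₂ least))))

    G : Poly R
    G = gb ∷ʳ 1#

    G-ann : AnnihilatesFrom N G a
    G-ann = proj₂ (proj₂ (proj₁ (proj₂ (proj₂ least))))

    minimal : ∀ e → e < d → ¬ MonicAnnihilator e
    minimal = proj₂ (proj₂ (proj₂ least))

    -- A nonzero top coefficient could be normalised away, giving a monic annihilator of smaller degree.
    no-short-annihilator : ∀ t → length t ≤ d → AnnihilatesFrom N t a → t ≅ []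
    no-short-annihilator = zero-top⇒≅[] zero-top
      where
      zero-top : ∀ t x → length t < d → AnnihilatesFrom N (t ∷ʳ x) a → x ≈ 0#
      zero-top t x |t|<d ann with x ≟ 0#
      ... | yes x≈0 = x≈0
      ... | no  x≉0 = ⊥-elim (minimal (length t) |t|<d
            (map (inverse x x≉0 *_) t , Listₚ.length-map _ t ,
             λ n N≤n → x*y≈0⇒y≈0 x≉0 (trans (sym (act-monic t x x≉0 a n)) (ann n N≤n))))

    -- If G₀ ≈ 0 then, by periodicity, dropping it leaves a monic annihilator of smaller degree.
    G₀≉0 : ¬ (coef G 0 ≈ 0#)
    G₀≉0 with gb | |gb| | G-ann
    ... | []      | _     | _   = 1≉0
    ... | g₀ ∷ gt | |gb|′ | ann = λ g₀≈0 → minimal (length gt) (ℕₚ.≤-reflexive |gb|′)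
                                   (gt , ≡.refl , annihilatesFrom-drop-coef₀ (g₀ ∷ gt ∷ʳ 1#) g₀≈0 ann)

    G∣ₚ : ∀ {p} → AnnihilatesFrom N p a → _∣ₚ_ R G p
    G∣ₚ {p} p-ann = monic-divides gb p a N G-ann p-ann
                      (λ t |t| → no-short-annihilator t (ℕₚ.≤-reflexive (≡.trans |t| |gb|)))

  period⇒order : ∀ k m → P R (suc k) m → O R (suc k) m
  period⇒order k zero      (_ , _ , ((() , _) , _))
  period⇒order k (suc m′) (a , (cs , _ , rec) , ((_ , N , periodic) , least-period)) =
    f , f-top≉0 , r , G , f≈X^r⊠G , coef₀≉0⇒coprime-X G G₀≉0 , s≤s z≤n ,
    G∣ₚ {X^-1 R (suc m′)} (λ n N≤n → periodic⇒annihilated (suc m′) a n (periodic n N≤n)) , least-order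
    where
    open MinimalPolynomial a N m′ periodic (suc k) (tabulate (λ i → - cs i)) (Listₚ.length-tabulate (λ i → - cs i))
                           (λ n _ → recurrence⇒charPoly-annihilates (suc k) cs a rec n)
    r : ℕ
    r = suc k ℕ.∸ d
    r+d : r ℕ.+ d ≡ suc k
    r+d = ℕₚ.m∸n+n≡m d≤K
    f : Fin (suc (suc k)) → F
    f i = coef (shiftₚ r G) (toℕ i)
    f-top≉0 : ¬ (f (fromℕ (suc k)) ≈ 0#)
    f-top≉0 f-top≈0 = 1≉0 (begin
      1#                            ≡⟨ ≡.sym (≡.trans (coef-shiftₚ r G d) (≡.subst (λ i → coef G i ≡ 1#) |gb| (coef-∷ʳ gb 1#))) ⟩
      coef (shiftₚ r G) (r ℕ.+ d)    ≡⟨ ≡.cong (coef (shiftₚ r G)) (≡.trans r+d (≡.sym (Finₚ.toℕ-fromℕ (suc k)))) ⟩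
      f (fromℕ (suc k))             ≈⟨ f-top≈0 ⟩
      0#                            ∎)
    |shiftG| : length (shiftₚ r G) ≤ suc (suc k)
    |shiftG| = ℕₚ.≤-reflexive (≡.trans (length-shiftₚ r G) (≡.trans (≡.cong (r ℕ.+_) (≡.trans (length-∷ʳ gb 1#) (≡.cong suc |gb|)))
                                (≡.trans (ℕₚ.+-suc r d) (≡.cong suc r+d))))
    f≈X^r⊠G : _≈ₚ_ R (toPoly R (suc k) f) (X^ R r ⊠ G)
    f≈X^r⊠G i = trans (tabulate-coef (suc (suc k)) (shiftₚ r G) |shiftG| i)
                      (sym (≅⇒≈ₚ {X^ R r ⊠ G} {shiftₚ r G} (X^⊠≅shiftₚ r G) i))
    least-order : ∀ n → 0 < n → _∣ₚ_ R G (X^-1 R n) → suc m′ ≤ n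
    least-order n 0<n G∣X^n-1 = least-period n (0<n , N , λ i N≤i →
      annihilated⇒periodic n a i (annihilatesFrom-∣ₚ {G} {X^-1 R n} G∣X^n-1 G-ann i N≤i))

lemma3p2 : ∀ {c ℓ} (R : CommutativeRing c ℓ) → IsField R
    → (q : ℕ) → IsPrimePower q → Bijection (setoid (Fin q)) (CommutativeRing.setoid R)
    → (k : ℕ) → 1 ≤ k → (m : ℕ) → (P R k m ⇔ O R k m)
lemma3p2 R isField q _ bij (suc k) (s≤s _) m =
  mk⇔ (PeriodToOrder.period⇒order R isField q bij k m)
      (OrderToPeriod.order⇒period R isField (FiniteField._≟_ R q bij) k m)
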